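{- Let $T$ be a triangulation of the annulus $C_{p,q}$ with $k\ge 1$ peripheral arcs, and let $\mu_\alpha=\mu_{\alpha_k}\cdots\mu_{\alpha_1}$ be a finite sequence of flips such that each $\alpha_p$ is a peripheral arc which is a bounding arc of the triangulation $\mu_{\alpha_{p-1}}\cdots\mu_{\alpha_1}T$, and such that $\mu_\alpha T$ is a bridging triangulation. Then the bridging triangulation $\tilde T=\mu_\alpha T$ is uniquely determined (up to labelling of arcs), i.e. it does not depend on the choice of such a sequence.
   Context: $C_{p,q}$ is an annulus with $p>0$ marked points on the outer boundary $\partial$ and $q>0$ on the inner boundary $\partial'$ ($p\ge q$). Arcs are taken up to isotopy (curves between marked points, not self-intersecting in the interior, interior disjoint from the boundary, not cutting out an unpunctured monogon or digon); a triangulation is a maximal collection of pairwise non-crossing arcs. An arc is peripheral if both endpoints lie on the same boundary component and bridging otherwise; a bridging triangulation consists only of bridging arcs. A flip $\mu_\gamma$ replaces the arc $\gamma$ by the other diagonal of the quadrilateral formed by the two triangles containing it. A peripheral arc $\gamma$ of a triangulation $T$ is bounding (with respect to $T$) if flipping it yields a bridging arc. -}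

module Defs where

-- Combinatorial model of arcs and triangulations of the annulus C_{p,q},
-- via the universal cover (the strip R × [0,1]).  Outer marked points lift
-- to the integers on the bottom line (point i ↦ i mod p), inner marked
-- points lift to the integers on the top line (j ↦ j mod q); the deck
-- transformation shifts the bottom by p and the top by q.

open import Data.Nat as ℕ using (ℕ; suc)
open import Data.Integer as ℤ using (ℤ; +_)
open import Data.Bool using (Bool; true; false)
open import Data.Empty using (⊥)
open import Data.Unit using (⊤)
open import Data.Product using (_×_; Σ; ∃₂)
open import Data.Sum using (_⊎_)
open import Data.List using (List; length; filterᵇ)
open import Data.List.Membership.Propositional using (_∈_)
open import Data.List.Relation.Unary.All using (All)
open import Data.List.Relation.Unary.Unique.Propositional using (Unique)
open import Relation.Nullary using (¬_)
open import Relation.Binary.PropositionalEquality using (_≡_; _≢_)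

-- Isotopy classes of arcs, in canonical form:
--  bridging i j : from outer point i (0 ≤ i < p) to the inner point whose
--                 lift is j ∈ ℤ (lift of the arc: bottom i — top j)
--  outerPer i d : peripheral on the outer boundary, lift from i to i+d
--                 (0 ≤ i < p, 2 ≤ d ≤ p)
--  innerPer j d : peripheral on the inner boundary, lift from j to j+d
--                 (0 ≤ j < q, 2 ≤ d ≤ q)
data Arc : Set where
  bridging : ℕ → ℤ → Arc
  outerPer : ℕ → ℕ → Arc
  innerPer : ℕ → ℕ → Arc

-- Validity (d = 1 would be a boundary segment, i.e. cut out a digon;
-- d > p resp. d > q would self-intersect).
Valid : ℕ → ℕ → Arc → Set
Valid p q (bridging i j) = i ℕ.< p
Valid p q (outerPer i d) = i ℕ.< p × 2 ℕ.≤ d × d ℕ.≤ p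
Valid p q (innerPer j d) = j ℕ.< q × 2 ℕ.≤ d × d ℕ.≤ q

Peripheral : Arc → Set
Peripheral (bridging _ _) = ⊥
Peripheral (outerPer _ _) = ⊤
Peripheral (innerPer _ _) = ⊤

Bridging : Arc → Set
Bridging (bridging _ _) = ⊤
Bridging (outerPer _ _) = ⊥
Bridging (innerPer _ _) = ⊥

isPeripheral : Arc → Bool
isPeripheral (bridging _ _) = false
isPeripheral (outerPer _ _) = true
isPeripheral (innerPer _ _) = true

data Seg : Set where
  bot : ℤ → ℤ → Seg   -- bottom a to bottom b, a < b
  top : ℤ → ℤ → Seg   -- top a to top b, a < b
  brg : ℤ → ℤ → Seg   -- bottom x to top y

lift : ℕ → ℕ → Arc → ℤ → Seg
lift p q (bridging i j) n = brg (+ i ℤ.+ n ℤ.* + p) (j ℤ.+ n ℤ.* + q)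
lift p q (outerPer i d) n = bot (+ i ℤ.+ n ℤ.* + p) (+ i ℤ.+ + d ℤ.+ n ℤ.* + p)
lift p q (innerPer j d) n = top (+ j ℤ.+ n ℤ.* + q) (+ j ℤ.+ + d ℤ.+ n ℤ.* + q)

-- two lifted arcs cross in the interior of the strip iff their endpoints
-- strictly interleave along the boundary of the strip
SegCross : Seg → Seg → Set
SegCross (bot a b) (bot c d) = (a ℤ.< c × c ℤ.< b × b ℤ.< d) ⊎ (c ℤ.< a × a ℤ.< d × d ℤ.< b)
SegCross (top a b) (top c d) = (a ℤ.< c × c ℤ.< b × b ℤ.< d) ⊎ (c ℤ.< a × a ℤ.< d × d ℤ.< b)
SegCross (bot _ _) (top _ _) = ⊥
SegCross (top _ _) (bot _ _) = ⊥
SegCross (bot a b) (brg x y) = a ℤ.< x × x ℤ.< b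
SegCross (brg x y) (bot a b) = a ℤ.< x × x ℤ.< b
SegCross (top a b) (brg x y) = a ℤ.< y × y ℤ.< b
SegCross (brg x y) (top a b) = a ℤ.< y × y ℤ.< b
SegCross (brg a b) (brg c d) = (a ℤ.< c × d ℤ.< b) ⊎ (c ℤ.< a × b ℤ.< d)

Cross : ℕ → ℕ → Arc → Arc → Set
Cross p q α β = ∃₂ λ (m n : ℤ) → SegCross (lift p q α m) (lift p q β n)

IsTriangulation : ℕ → ℕ → List Arc → Set
IsTriangulation p q T =
  Unique T × All (Valid p q) T
  × (∀ a b → a ∈ T → b ∈ T → ¬ Cross p q a b)
  × (∀ a → Valid p q a → (∀ b → b ∈ T → ¬ Cross p q a b) → a ∈ T)

IsBridgingTriangulation : ℕ → ℕ → List Arc → Set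
IsBridgingTriangulation p q T = IsTriangulation p q T × All Bridging T

-- same set of arcs (equality up to labelling)
SameArcs : List Arc → List Arc → Set
SameArcs T T' = ∀ a → (a ∈ T → a ∈ T') × (a ∈ T' → a ∈ T)

numPeripheral : List Arc → ℕ
numPeripheral T = length (filterᵇ isPeripheral T)

-- flip of γ in T: γ is replaced by a different arc γ' and the result is
-- again a triangulation (γ' is the other diagonal of the quadrilateral)
Flip : ℕ → ℕ → List Arc → Arc → Arc → List Arc → Set
Flip p q T γ γ' T' =
  γ ∈ T × IsTriangulation p q T' × γ' ≢ γ
  × (∀ a → (a ∈ T' → (a ∈ T × a ≢ γ) ⊎ a ≡ γ') × ((a ∈ T × a ≢ γ) ⊎ a ≡ γ' → a ∈ T'))

-- flipping a bounding arc γ of T: γ is peripheral and its flip is bridging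
BoundingFlip : ℕ → ℕ → List Arc → Arc → List Arc → Set
BoundingFlip p q T γ T' = Peripheral γ × Σ Arc (λ γ' → Bridging γ' × Flip p q T γ γ' T')

data BoundingFlipSeq (p q : ℕ) : ℕ → List Arc → List Arc → Set where
  done : ∀ {T} → BoundingFlipSeq p q 0 T T
  step : ∀ {n T T₁ T₂ γ} → BoundingFlip p q T γ T₁
       → BoundingFlipSeq p q n T₁ T₂ → BoundingFlipSeq p q (suc n) T T₂

-- A flip at a bounding arc removes a peripheral arc, so every bridging arc of
-- T survives in both bridging triangulations T₁ and T₂.  It therefore suffices
-- that two bridging arcs, neither of which crosses a bridging arc of T, never
-- cross each other: then T₁ ∪ T₂ is non-crossing and maximality gives T₁ = T₂.
--
-- Argue in the universal cover.  Suppose lifts (a,b) and (e,f) of such arcs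
-- cross, with a < e and f < b.  T has a bridging arc: the outer (inner)
-- peripheral lifts are nested intervals of bounded length, so some bottom
-- (top) point lies under none of them, and the segment joining two such points
-- can only cross bridging lifts.  Translating a bridging lift of T gives one
-- lying to the left of both segments and one lying to the right.  Among such
-- pairs (x,y), (x′,y′), the fan segment (x,y′) is a lift of T by maximality:
-- any lift of T crossing it would lie, again, entirely to the left or to the
-- right, and give a closer pair.  But (x,y′) crosses (e,f).
module Submission where

open import Defs
open import Data.List using (List)
open import Data.List.Membership.Propositional using (_∈_)
import Data.List.Relation.Unary.All as All
open import Data.Product using (Σ; _×_; _,_; proj₁; proj₂)
open import Data.Sum using (_⊎_; inj₁; inj₂)
open import Data.Empty using (⊥)
open import Relation.Nullary using (¬_; yes; no)
open import Relation.Binary.PropositionalEquality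
  using (_≡_; _≢_; refl; sym; trans; cong; cong₂; subst; subst₂)

_⊆ᵇ_ : List Arc → List Arc → Set
T ⊆ᵇ T′ = ∀ {a} → a ∈ T → Bridging a → a ∈ T′

bridging≢peripheral : ∀ {a γ} → Bridging a → Peripheral γ → a ≢ γ
bridging≢peripheral {bridging _ _} {bridging _ _} _ ()
bridging≢peripheral {bridging _ _} {outerPer _ _} _ _ ()
bridging≢peripheral {bridging _ _} {innerPer _ _} _ _ ()
bridging≢peripheral {outerPer _ _} ()
bridging≢peripheral {innerPer _ _} ()

bridgingArcs-persist : ∀ {p q n T T′} → BoundingFlipSeq p q n T T′ → T ⊆ᵇ T′
bridgingArcs-persist done a∈T _ = a∈T
bridgingArcs-persist (step (γ-peripheral , _ , _ , _ , _ , _ , flipped) rest) {a} a∈T a-bridging =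
  bridgingArcs-persist rest
    (proj₂ (flipped a) (inj₁ (a∈T , bridging≢peripheral a-bridging γ-peripheral)))
    a-bridging

module UniversalCover where

  open import Data.Nat as ℕ using (ℕ; NonZero)
  import Data.Nat.Properties as ℕₚ
  open import Data.Integer
    using (ℤ; +_; -[1+_]; -_; _+_; _-_; _*_; _<_; _≤_; _≤?_; ∣_∣; -1ℤ; +≤+; +<+; -≤+)
  open import Data.Integer.Properties
  open import Data.Integer.DivMod using (_/ℕ_; _%ℕ_; a≡a%ℕn+[a/ℕn]*n; n%ℕd<d)
  open import Data.Integer.Tactic.RingSolver using (solve-∀)

  private
    pred-+-suc : ∀ i m → - + 1 + (i + (+ 1 + m)) ≡ i + m
    pred-+-suc = solve-∀

    +-suc-comm : ∀ i m → i + (+ 1 + m) ≡ + 1 + i + m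
    +-suc-comm = solve-∀

    +-[-+]-cancel : ∀ i j → i + (j - i) ≡ j
    +-[-+]-cancel = solve-∀

    -+-cancel : ∀ i j → i - j + j ≡ i
    -+-cancel = solve-∀

    +-*-distrib : ∀ a m k c → a + (m + k) * c ≡ a + m * c + k * c
    +-*-distrib = solve-∀

    +-rotate : ∀ i d o → i + d + o ≡ d + (i + o)
    +-rotate = solve-∀

    shift-split : ∀ x a c → x + (- c) ≡ (x - a) + (a - c)
    shift-split = solve-∀

  i≤+∣i∣ : ∀ i → i ≤ + ∣ i ∣
  i≤+∣i∣ (+ _) = ≤-refl
  i≤+∣i∣ -[1+ _ ] = -≤+

  <-suc-absorbˡ : ∀ {i j k} n → i < j → j < k + + ℕ.suc n → i < k + + n
  <-suc-absorbˡ {i} {j} {k} n i<j j<k+1+n =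
    subst₂ _<_ (pred-suc i) (pred-+-suc k (+ n))
      (+-monoʳ-< -1ℤ (≤-<-trans (i<j⇒suc[i]≤j i<j) j<k+1+n))

  <-suc-absorbʳ : ∀ {i j k} n → i < j + + ℕ.suc n → j < k → i < k + + n
  <-suc-absorbʳ {i} {j} {k} n i<j+1+n j<k =
    <-≤-trans i<j+1+n
      (subst (_≤ k + + n) (sym (+-suc-comm j (+ n))) (+-monoˡ-≤ (+ n) (i<j⇒suc[i]≤j j<k)))

  exceeds-by : ∀ i j → Σ ℕ λ n → i < j + + n
  exceeds-by i j = ℕ.suc ∣ i - j ∣ ,
    (begin-strict
      i                     ≡⟨ sym (+-[-+]-cancel j i) ⟩
      j + (i - j)           ≤⟨ +-monoʳ-≤ j (i≤+∣i∣ (i - j)) ⟩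
      j + + ∣ i - j ∣       <⟨ +-monoʳ-< j (+<+ (ℕₚ.n<1+n _)) ⟩
      j + + ℕ.suc ∣ i - j ∣ ∎)
    where open ≤-Reasoning

  ≤-multiple : ∀ i K P .{{_ : NonZero P}} → ∣ i ∣ ℕ.≤ K → i ≤ + K * + P
  ≤-multiple i K P ∣i∣≤K = begin
    i           ≤⟨ i≤+∣i∣ i ⟩
    + ∣ i ∣     ≤⟨ +≤+ (ℕₚ.≤-trans ∣i∣≤K (ℕₚ.m≤m*n K P)) ⟩
    + (K ℕ.* P) ≡⟨ pos-* K P ⟩
    + K * + P   ∎
    where open ≤-Reasoning

  shiftDown-≤ : ∀ x a K P .{{_ : NonZero P}} → ∣ x - a ∣ ℕ.≤ K → x + (- + K) * + P ≤ a
  shiftDown-≤ x a K P bound = begin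
    x + (- + K) * + P           ≡⟨ cong (λ z → x + z) (sym (neg-distribˡ-* (+ K) (+ P))) ⟩
    x + - (+ K * + P)           ≡⟨ shift-split x a (+ K * + P) ⟩
    (x - a) + (a - + K * + P)   ≤⟨ +-monoˡ-≤ (a - + K * + P) (≤-multiple (x - a) K P bound) ⟩
    + K * + P + (a - + K * + P) ≡⟨ +-[-+]-cancel (+ K * + P) a ⟩
    a                           ∎
    where open ≤-Reasoning

  shiftUp-≥ : ∀ x a K P .{{_ : NonZero P}} → ∣ a - x ∣ ℕ.≤ K → a ≤ x + + K * + P
  shiftUp-≥ x a K P bound = begin
    a              ≡⟨ sym (-+-cancel a x) ⟩
    a - x + x      ≤⟨ +-monoˡ-≤ x (≤-multiple (a - x) K P bound) ⟩
    + K * + P + x  ≡⟨ +-comm (+ K * + P) x ⟩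
    x + + K * + P  ∎
    where open ≤-Reasoning

  translate : ℤ → ℤ → Seg → Seg
  translate c d (bot a b) = bot (a + c) (b + c)
  translate c d (top a b) = top (a + d) (b + d)
  translate c d (brg x y) = brg (x + c) (y + d)

  SegCross-translate : ∀ c d s s′ → SegCross s s′ → SegCross (translate c d s) (translate c d s′)
  SegCross-translate c d (bot _ _) (bot _ _) (inj₁ (u , v , w)) = inj₁ (+-monoˡ-< c u , +-monoˡ-< c v , +-monoˡ-< c w)
  SegCross-translate c d (bot _ _) (bot _ _) (inj₂ (u , v , w)) = inj₂ (+-monoˡ-< c u , +-monoˡ-< c v , +-monoˡ-< c w)
  SegCross-translate c d (top _ _) (top _ _) (inj₁ (u , v , w)) = inj₁ (+-monoˡ-< d u , +-monoˡ-< d v , +-monoˡ-< d w)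
  SegCross-translate c d (top _ _) (top _ _) (inj₂ (u , v , w)) = inj₂ (+-monoˡ-< d u , +-monoˡ-< d v , +-monoˡ-< d w)
  SegCross-translate c d (bot _ _) (brg _ _) (u , v) = +-monoˡ-< c u , +-monoˡ-< c v
  SegCross-translate c d (brg _ _) (bot _ _) (u , v) = +-monoˡ-< c u , +-monoˡ-< c v
  SegCross-translate c d (top _ _) (brg _ _) (u , v) = +-monoˡ-< d u , +-monoˡ-< d v
  SegCross-translate c d (brg _ _) (top _ _) (u , v) = +-monoˡ-< d u , +-monoˡ-< d v
  SegCross-translate c d (brg _ _) (brg _ _) (inj₁ (u , v)) = inj₁ (+-monoˡ-< c u , +-monoˡ-< d v)
  SegCross-translate c d (brg _ _) (brg _ _) (inj₂ (u , v)) = inj₂ (+-monoˡ-< c u , +-monoˡ-< d v)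

  shift : ℕ → ℕ → ℤ → Seg → Seg
  shift p q k = translate (k * + p) (k * + q)

  lift-+ : ∀ p q t m k → lift p q t (m + k) ≡ shift p q k (lift p q t m)
  lift-+ p q (bridging i j) m k = cong₂ brg (+-*-distrib (+ i) m k (+ p)) (+-*-distrib j m k (+ q))
  lift-+ p q (outerPer i d) m k = cong₂ bot (+-*-distrib (+ i) m k (+ p)) (+-*-distrib (+ i + + d) m k (+ p))
  lift-+ p q (innerPer j d) m k = cong₂ top (+-*-distrib (+ j) m k (+ q)) (+-*-distrib (+ j + + d) m k (+ q))

  Cross⇒liftCross : ∀ {p q a b} N → Cross p q a b → Σ ℤ λ n → SegCross (lift p q a N) (lift p q b n)
  Cross⇒liftCross {p} {q} {a} {b} N (m , n , c) =
    n + (N - m) ,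
    subst₂ SegCross
      (trans (sym (lift-+ p q a m (N - m))) (cong (lift p q a) (+-[-+]-cancel m N)))
      (sym (lift-+ p q b n (N - m)))
      (SegCross-translate _ _ (lift p q a m) (lift p q b n) c)

  peripheralLift-bounds : ∀ {d P} (i o : ℤ) → 2 ℕ.≤ d → d ℕ.≤ P
    → i + o < i + + d + o × i + + d + o ≤ i + o + + P
  peripheralLift-bounds {d} {P} i o 2≤d d≤P =
    subst₂ _<_ (+-identityˡ (i + o)) (sym shape) (+-monoˡ-< (i + o) (+<+ (ℕₚ.<-≤-trans ℕ.z<s 2≤d))) ,
    subst₂ _≤_ (sym shape) (+-comm (+ P) (i + o)) (+-monoˡ-≤ (i + o) (+≤+ d≤P))
    where
    shape : i + + d + o ≡ + d + (i + o)
    shape = +-rotate i (+ d) o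

  Interleaved : ℤ → ℤ → ℤ → ℤ → Set
  Interleaved a b c d = (a < c × c < b × b < d) ⊎ (c < a × a < d × d < b)

  nested : ∀ {u v u′ v′} → ¬ Interleaved u v u′ v′ → u′ < u → u < v′ → v ≤ v′
  nested ¬interleaved u′<u u<v′ = ≮⇒≥ λ v′<v → ¬interleaved (inj₂ (u′<u , u<v′ , v′<v))

  Uncovered : (ℤ → ℤ → Set) → ℤ → Set
  Uncovered S x = ∀ {u v} → S u v → u < x → x < v → ⊥

  ¬allCovered : (S : ℤ → ℤ → Set) (N : ℕ)
    → (∀ {u v} → S u v → u < v × v ≤ u + + N)
    → (∀ {u v u′ v′} → S u v → S u′ v′ → ¬ Interleaved u v u′ v′)
    → ¬ (∀ x → ¬ Uncovered S x)
  ¬allCovered S N bounded laminar covered =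
    descend N (+ 0) λ s _ _ → +-monoˡ-< (+ N) (proj₁ (bounded s))
    where
    -- Invariant: every interval covering x is longer than N − n.  Moving x to
    -- the left end of a covering interval keeps it, with one unit to spare,
    -- because by laminarity the intervals covering that end contain it.
    descend : ∀ n x → (∀ {u v} → S u v → u < x → x < v → u + + N < v + + n) → ⊥
    descend ℕ.zero x longer = covered x λ s u<x x<v →
      ≤⇒≯ (proj₂ (bounded s)) (subst (_ <_) (+-identityʳ _) (longer s u<x x<v))
    descend (ℕ.suc n) x longer = covered x λ s u<x x<v → descend n _ λ {_} {v′} s′ u′<u u<v′ →
      <-suc-absorbˡ {k = v′} n (+-monoˡ-< (+ N) u′<u)
        (<-≤-trans (longer s u<x x<v) (+-monoˡ-≤ (+ ℕ.suc n) (nested (laminar s s′) u′<u u<v′)))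

  module Lifts (p q : ℕ) {{_ : NonZero p}} {{_ : NonZero q}}
               (T : List Arc) (tri : IsTriangulation p q T) where

    private
      valid : All.All (Valid p q) T
      valid = proj₁ (proj₂ tri)

      noncrossing : ∀ a b → a ∈ T → b ∈ T → ¬ Cross p q a b
      noncrossing = proj₁ (proj₂ (proj₂ tri))

      maximal : ∀ a → Valid p q a → (∀ b → b ∈ T → ¬ Cross p q a b) → a ∈ T
      maximal = proj₂ (proj₂ (proj₂ tri))

    Lift : Seg → Set
    Lift s = Σ Arc λ t → t ∈ T × Σ ℤ λ n → lift p q t n ≡ s

    lifts-noncrossing : ∀ {s s′} → Lift s → Lift s′ → ¬ SegCross s s′
    lifts-noncrossing (t , t∈T , m , refl) (t′ , t′∈T , n , refl) c = noncrossing t t′ t∈T t′∈T (m , n , c)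

    Lift-shift : ∀ {s} k → Lift s → Lift (shift p q k s)
    Lift-shift k (t , t∈T , m , refl) = t , t∈T , m + k , lift-+ p q t m k

    uncrossed⇒Lift : ∀ x y → (∀ s → Lift s → ¬ SegCross (brg x y) s) → Lift (brg x y)
    uncrossed⇒Lift x y uncrossed = arc , arc∈T , x /ℕ p , lift-arc
      where
      arc : Arc
      arc = bridging (x %ℕ p) (y - (x /ℕ p) * + q)
      lift-arc : lift p q arc (x /ℕ p) ≡ brg x y
      lift-arc = cong₂ brg (sym (a≡a%ℕn+[a/ℕn]*n x p)) (-+-cancel y ((x /ℕ p) * + q))
      arc∈T : arc ∈ T
      arc∈T = maximal arc (n%ℕd<d x p) λ b b∈T cross →
        let (n , c) = Cross⇒liftCross {a = arc} {b = b} (x /ℕ p) cross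
        in uncrossed _ (b , b∈T , n , refl) (subst (λ s → SegCross s (lift p q b n)) lift-arc c)

    outerLift-bounds : ∀ {u v} → Lift (bot u v) → u < v × v ≤ u + + p
    outerLift-bounds (outerPer i d , t∈T , n , refl) with All.lookup valid t∈T
    ... | _ , 2≤d , d≤p = peripheralLift-bounds (+ i) (n * + p) 2≤d d≤p
    outerLift-bounds (bridging _ _ , _ , _ , ())
    outerLift-bounds (innerPer _ _ , _ , _ , ())

    innerLift-bounds : ∀ {u v} → Lift (top u v) → u < v × v ≤ u + + q
    innerLift-bounds (innerPer j d , t∈T , n , refl) with All.lookup valid t∈T
    ... | _ , 2≤d , d≤q = peripheralLift-bounds (+ j) (n * + q) 2≤d d≤q
    innerLift-bounds (bridging _ _ , _ , _ , ())
    innerLift-bounds (outerPer _ _ , _ , _ , ())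

    ¬¬bridgingLift : ¬ (∀ x y → ¬ Lift (brg x y))
    ¬¬bridgingLift none =
      ¬allCovered (λ u v → Lift (bot u v)) p outerLift-bounds lifts-noncrossing λ x x-free →
      ¬allCovered (λ u v → Lift (top u v)) q innerLift-bounds lifts-noncrossing λ y y-free →
      none x y (uncrossed⇒Lift x y λ
        { (bot u v) ℓ (u<x , x<v) → x-free ℓ u<x x<v
        ; (top u v) ℓ (u<y , y<v) → y-free ℓ u<y y<v
        ; (brg x′ y′) ℓ _ → none x′ y′ ℓ })

    liftBelow : ∀ {x y} → Lift (brg x y) → ∀ a f
      → Σ ℤ λ x′ → Σ ℤ λ y′ → Lift (brg x′ y′) × x′ ≤ a × y′ ≤ f
    liftBelow {x} {y} ℓ a f =
      _ , _ , Lift-shift (- + K) ℓ ,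
      shiftDown-≤ x a K p (ℕₚ.m≤m+n _ _) , shiftDown-≤ y f K q (ℕₚ.m≤n+m _ _)
      where
      K : ℕ
      K = ∣ x - a ∣ ℕ.+ ∣ y - f ∣

    liftAbove : ∀ {x y} → Lift (brg x y) → ∀ e b
      → Σ ℤ λ x′ → Σ ℤ λ y′ → Lift (brg x′ y′) × e ≤ x′ × b ≤ y′
    liftAbove {x} {y} ℓ e b =
      _ , _ , Lift-shift (+ K) ℓ ,
      shiftUp-≥ x e K p (ℕₚ.m≤m+n _ _) , shiftUp-≥ y b K q (ℕₚ.m≤n+m _ _)
      where
      K : ℕ
      K = ∣ e - x ∣ ℕ.+ ∣ b - y ∣

    Avoids : ℤ → ℤ → Set
    Avoids a b = ∀ {x y} → Lift (brg x y) → ¬ SegCross (brg a b) (brg x y)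

    module Separation {a b e f} (avoids₁ : Avoids a b) (avoids₂ : Avoids e f)
                      (a<e : a < e) (f<b : f < b) where

      LeftOf : ℤ → ℤ → Set
      LeftOf x y = x ≤ a × y ≤ f

      RightOf : ℤ → ℤ → Set
      RightOf x y = e ≤ x × b ≤ y

      left<right : ∀ {x y x′ y′} → LeftOf x y → RightOf x′ y′ → x < x′ × y < y′
      left<right (x≤a , y≤f) (e≤x′ , b≤y′) =
        ≤-<-trans x≤a (<-≤-trans a<e e≤x′) , ≤-<-trans y≤f (<-≤-trans f<b b≤y′)

      leftOf⊎rightOf : ∀ {x y} → Lift (brg x y) → LeftOf x y ⊎ RightOf x y
      leftOf⊎rightOf {x} {y} ℓ with x ≤? a
      ... | yes x≤a = inj₁ (x≤a , ≮⇒≥ λ f<y → avoids₂ ℓ (inj₂ (≤-<-trans x≤a a<e , f<y)))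
      ... | no x≰a = inj₂ (≮⇒≥ (λ x<e → avoids₂ ℓ (inj₂ (x<e , <-≤-trans f<b b≤y))) , b≤y)
        where
        b≤y : b ≤ y
        b≤y = ≮⇒≥ λ y<b → avoids₁ ℓ (inj₁ (≰⇒> x≰a , y<b))

      noSeparatingPair : ∀ n {x y x′ y′} → Lift (brg x y) → LeftOf x y
        → Lift (brg x′ y′) → RightOf x′ y′ → x′ + y′ < x + y + + n → ⊥
      noSeparatingPair ℕ.zero _ left _ right lt =
        let (x<x′ , y<y′) = left<right left right
        in <-asym lt (subst (_< _) (sym (+-identityʳ _)) (+-mono-< x<x′ y<y′))
      noSeparatingPair (ℕ.suc n) {x} {y} {x′} {y′} ℓ left ℓ′ right lt =
        avoids₂ fan (inj₂ (≤-<-trans (proj₁ left) a<e , <-≤-trans f<b (proj₂ right)))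
        where
        y<y′ : y < y′
        y<y′ = proj₂ (left<right left right)

        between : ∀ {x₀ y₀} → Lift (brg x₀ y₀) → x < x₀ → y₀ < y′ → ⊥
        between {x₀} {y₀} ℓ₀ x<x₀ y₀<y′ with y ≤? y₀ | x₀ ≤? x′
        ... | no y≰y₀ | _ = lifts-noncrossing ℓ ℓ₀ (inj₁ (x<x₀ , ≰⇒> y≰y₀))
        ... | yes _ | no x₀≰x′ = lifts-noncrossing ℓ′ ℓ₀ (inj₁ (≰⇒> x₀≰x′ , y₀<y′))
        ... | yes y≤y₀ | yes x₀≤x′ with leftOf⊎rightOf ℓ₀
        ...   | inj₁ left₀ = noSeparatingPair n ℓ₀ left₀ ℓ′ right
                  (<-suc-absorbʳ n lt (+-mono-<-≤ x<x₀ y≤y₀))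
        ...   | inj₂ right₀ = noSeparatingPair n ℓ left ℓ₀ right₀
                  (<-suc-absorbˡ {k = x + y} n (+-mono-≤-< x₀≤x′ y₀<y′) lt)

        fan : Lift (brg x y′)
        fan = uncrossed⇒Lift x y′ λ
          { (bot _ _) ℓ₀ c → lifts-noncrossing ℓ ℓ₀ c
          ; (top _ _) ℓ₀ c → lifts-noncrossing ℓ′ ℓ₀ c
          ; (brg _ _) ℓ₀ (inj₁ (x<x₀ , y₀<y′)) → between ℓ₀ x<x₀ y₀<y′
          ; (brg _ _) ℓ₀ (inj₂ (x₀<x , y′<y₀)) → lifts-noncrossing ℓ ℓ₀ (inj₂ (x₀<x , <-trans y<y′ y′<y₀)) }

      impossible : ⊥
      impossible = ¬¬bridgingLift λ _ _ ℓ →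
        let (xL , yL , ℓL , left) = liftBelow ℓ a f
            (xR , yR , ℓR , right) = liftAbove ℓ e b
            (n , lt) = exceeds-by (xR + yR) (xL + yL)
        in noSeparatingPair n ℓL left ℓR right lt

    avoiders-noncrossing : ∀ {a b e f} → Avoids a b → Avoids e f → ¬ SegCross (brg a b) (brg e f)
    avoiders-noncrossing avoids₁ avoids₂ (inj₁ (a<e , f<b)) = Separation.impossible avoids₁ avoids₂ a<e f<b
    avoiders-noncrossing avoids₁ avoids₂ (inj₂ (e<a , b<f)) = Separation.impossible avoids₂ avoids₁ e<a b<f

    extension-avoids : ∀ {T′} → IsTriangulation p q T′ → T ⊆ᵇ T′
      → ∀ {i j} → bridging i j ∈ T′ → ∀ m → Avoids (+ i + m * + p) (j + m * + q)
    extension-avoids tri′ T⊆ᵇT′ arc∈T′ m (bridging _ _ , t∈T , n , refl) c =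
      proj₁ (proj₂ (proj₂ tri′)) _ _ arc∈T′ (T⊆ᵇT′ t∈T _) (m , n , c)
    extension-avoids tri′ T⊆ᵇT′ arc∈T′ m (outerPer _ _ , _ , _ , ())
    extension-avoids tri′ T⊆ᵇT′ arc∈T′ m (innerPer _ _ , _ , _ , ())

    extensions-noncrossing : ∀ {T₁ T₂} → IsTriangulation p q T₁ → IsTriangulation p q T₂
      → T ⊆ᵇ T₁ → T ⊆ᵇ T₂ → ∀ {a b} → a ∈ T₁ → b ∈ T₂ → Bridging a → Bridging b → ¬ Cross p q a b
    extensions-noncrossing tri₁ tri₂ T⊆ᵇT₁ T⊆ᵇT₂ {bridging _ _} {bridging _ _} a∈T₁ b∈T₂ _ _ (m , n , c) =
      avoiders-noncrossing (extension-avoids tri₁ T⊆ᵇT₁ a∈T₁ m) (extension-avoids tri₂ T⊆ᵇT₂ b∈T₂ n) c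

open UniversalCover using (module Lifts)
open import Data.Nat using (ℕ; _<_; _≤_; NonZero; >-nonZero)

bridgingExtension-⊆ : ∀ p q {{_ : NonZero p}} {{_ : NonZero q}} {T T₁ T₂}
  → IsTriangulation p q T → T ⊆ᵇ T₁ → T ⊆ᵇ T₂
  → IsBridgingTriangulation p q T₁ → IsBridgingTriangulation p q T₂
  → ∀ {a} → a ∈ T₁ → a ∈ T₂
bridgingExtension-⊆ p q tri T⊆ᵇT₁ T⊆ᵇT₂ (tri₁ , bridging₁) (tri₂ , bridging₂) {a} a∈T₁ =
  proj₂ (proj₂ (proj₂ tri₂)) a (All.lookup (proj₁ (proj₂ tri₁)) a∈T₁) λ b b∈T₂ →
    Lifts.extensions-noncrossing p q _ tri tri₁ tri₂ T⊆ᵇT₁ T⊆ᵇT₂ a∈T₁ b∈T₂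
      (All.lookup bridging₁ a∈T₁) (All.lookup bridging₂ b∈T₂)

mainTheorem4 : (p q : ℕ) → 0 < p → 0 < q → q ≤ p
    → (T : List Arc) → IsTriangulation p q T
    → (k : ℕ) → k ≡ numPeripheral T → 1 ≤ k
    → (T₁ T₂ : List Arc)
    → BoundingFlipSeq p q k T T₁ → IsBridgingTriangulation p q T₁
    → BoundingFlipSeq p q k T T₂ → IsBridgingTriangulation p q T₂
    → SameArcs T₁ T₂
mainTheorem4 p q 0<p 0<q _ T tri _ _ _ T₁ T₂ flips₁ bridging₁ flips₂ bridging₂ _ =
  bridgingExtension-⊆ p q tri T⊆ᵇT₁ T⊆ᵇT₂ bridging₁ bridging₂ ,
  bridgingExtension-⊆ p q tri T⊆ᵇT₂ T⊆ᵇT₁ bridging₂ bridging₁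
  where
  instance
    p≢0 : NonZero p
    p≢0 = >-nonZero 0<p
    q≢0 : NonZero q
    q≢0 = >-nonZero 0<q
  T⊆ᵇT₁ : T ⊆ᵇ T₁
  T⊆ᵇT₁ = bridgingArcs-persist flips₁
  T⊆ᵇT₂ : T ⊆ᵇ T₂
  T⊆ᵇT₂ = bridgingArcs-persist flips₂
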